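{- There exists an isomorphism $G^*/M\cong \check F-E(\check F_0)$ that maps the vertices $0$ and $1$ to the two vertices of $\check F_0$.
   Context: Cantor intervals: $\mathcal{C}_0:=\{[0,1]\}$, and $\mathcal{C}_{n+1}$ is obtained from $\mathcal{C}_n$ by replacing each interval $[a,a+\Delta]$ with $[a,a+\tfrac13\Delta]$ and $[a+\tfrac23\Delta,a+\Delta]$. For $n\ge1$ let $C_n^*:=\{x,y : [x,y]\in\mathcal{C}_n\}\subseteq\mathbb{Q}$, $E_n^*:=\{\{a,a+\tfrac23\Delta\},\{a+\tfrac13\Delta,a+\tfrac23\Delta\},\{a+\tfrac13\Delta,a+\Delta\} : [a,a+\Delta]\in\mathcal{C}_{n-1}\}$ and $M_n:=\{\{a+\tfrac13\Delta,a+\tfrac23\Delta\} : [a,a+\Delta]\in\mathcal{C}_{n-1}\}$. Let $G^*$ be the graph with vertex set $\bigcup_{n\ge1}C_n^*$ and edge set $\bigcup_{n\ge1}E_n^*$, and $M:=\bigcup_{n\ge1}M_n$ (an independent set of edges). $G^*/M$ is obtained from $G^*$ by contracting all edges in $M$. Halved Farey graph: $\check F_0$ is a $K^2$ whose sole edge is coloured blue; $\check F_{n+1}$ is obtained from $\check F_n$ by adding, for every blue edge $e$ of $\check F_n$, a new vertex $v_e$ joined precisely to the two endvertices of $e$ by two blue edges, and recolouring all edges of $\check F_n$ black. $\check F:=\bigcup_{n}\check F_n$ (ignoring colours). $\check F-E(\check F_0)$ is $\check F$ with the edge of $\check F_0$ deleted. -}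

module Defs where

open import Data.Nat using (ℕ; zero; suc)
open import Data.Integer using (+_)
open import Data.Rational using (ℚ; 0ℚ; 1ℚ; _+_; _*_; _/_)
open import Data.Product using (Σ; ∃; ∃-syntax; _×_; _,_)
open import Data.Sum using (_⊎_)
open import Relation.Nullary using (¬_)
open import Relation.Binary.PropositionalEquality using (_≡_)

third twoThirds : ℚ
third = + 1 / 3
twoThirds = + 2 / 3

-- Cantor intervals.  CInt n a Δ  means  [a, a+Δ] ∈ 𝒞_n.

data CInt : ℕ → ℚ → ℚ → Set where
  base  : CInt 0 0ℚ 1ℚ
  left  : ∀ {n a d} → CInt n a d → CInt (suc n) a (d * third)
  right : ∀ {n a d} → CInt n a d → CInt (suc n) (a + d * twoThirds) (d * third)

CStar : ℕ → ℚ → Set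
CStar n x = ∃[ a ] ∃[ d ] (CInt n a d × (x ≡ a ⊎ x ≡ a + d))

SamePair : ℚ → ℚ → ℚ → ℚ → Set
SamePair x y u v = (x ≡ u × y ≡ v) ⊎ (x ≡ v × y ≡ u)

-- {x,y} ∈ E*_{n+1}   (built from [a,a+Δ] ∈ 𝒞_n)
EStar : ℕ → ℚ → ℚ → Set
EStar n x y = ∃[ a ] ∃[ d ] (CInt n a d ×
  (SamePair x y a (a + d * twoThirds)
   ⊎ SamePair x y (a + d * third) (a + d * twoThirds)
   ⊎ SamePair x y (a + d * third) (a + d)))

-- {x,y} ∈ M_{n+1}
MStar : ℕ → ℚ → ℚ → Set
MStar n x y = ∃[ a ] ∃[ d ] (CInt n a d ×
  SamePair x y (a + d * third) (a + d * twoThirds))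

GVert : ℚ → Set
GVert x = ∃[ n ] CStar (suc n) x

GEdge : ℚ → ℚ → Set
GEdge x y = ∃[ n ] EStar n x y

MEdge : ℚ → ℚ → Set
MEdge x y = ∃[ n ] MStar n x y

-- G*/M: vertices are the classes of the relation "equal or joined by an
-- M-edge" (an equivalence since M is a matching); two classes are adjacent
-- iff they are distinct and some G*-edge joins representatives of them.
_≈M_ : ℚ → ℚ → Set
x ≈M y = x ≡ y ⊎ MEdge x y

QAdj : ℚ → ℚ → Set
QAdj x y = ¬ (x ≈M y) × ∃[ x' ] ∃[ y' ] (x ≈M x' × y ≈M y' × GEdge x' y')

-- Vertices are named by terms: l, r are the two
-- vertices of F̌_0, and  mid x y  is the vertex v_e added for the blue
-- edge e = xy.  Blue n x y : xy is a blue edge of F̌_n (with the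
-- orientation in which it was created).

data FV : Set where
  l r : FV
  mid : FV → FV → FV

data Blue : ℕ → FV → FV → Set where
  blue0 : Blue 0 l r
  blueL : ∀ {n x y} → Blue n x y → Blue (suc n) x (mid x y)
  blueR : ∀ {n x y} → Blue n x y → Blue (suc n) (mid x y) y

-- vertices of F̌ = ⋃ F̌_n (every vertex lies on a blue edge of the stage
-- at which it appears)
FVert : FV → Set
FVert v = ∃[ n ] ∃[ w ] (Blue n v w ⊎ Blue n w v)

-- edges of F̌ = ⋃ F̌_n, colours ignored (each edge is blue at its creation)
FEdge : FV → FV → Set
FEdge x y = ∃[ n ] (Blue n x y ⊎ Blue n y x)

FEdge⁻ : FV → FV → Set
FEdge⁻ x y = FEdge x y × ¬ ((x ≡ l × y ≡ r) ⊎ (x ≡ r × y ≡ l))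

-- An isomorphism G*/M ≅ F̌ − E(F̌_0), given by a map f on representatives.

record IsQuotIso (f : ℚ → FV) : Set where
  field
    into     : ∀ x → GVert x → FVert (f x)
    onto     : ∀ v → FVert v → ∃[ x ] (GVert x × f x ≡ v)
    respect  : ∀ x y → GVert x → GVert y → x ≈M y → f x ≡ f y
    reflect  : ∀ x y → GVert x → GVert y → f x ≡ f y → x ≈M y
    adj→     : ∀ x y → GVert x → GVert y → QAdj x y → FEdge⁻ (f x) (f y)
    adj←     : ∀ x y → GVert x → GVert y → FEdge⁻ (f x) (f y) → QAdj x y

-- The isomorphism is the map  toFarey : ℚ → FV  that follows a point down the
-- Cantor construction: [0,1] carries the labels (l, r); a point of the left
-- (right) third is rescaled to [0,1] while the label pair (L, R) becomes
-- (L, mid L R) (resp. (mid L R, R)); the search stops with label L, R or mid L R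
-- when the point is 0, 1 or one of the division points 1/3, 2/3.  Denominators
-- give enough fuel: a division point of an interval of 𝒞ₙ has the form
-- (3A + j)/3ⁿ⁺¹ with j ∈ {1,2}, so its reduced denominator is divisible by 3ⁿ⁺¹.
--
-- Intervals of 𝒞ₙ correspond bijectively to blue
-- edges of F̌ₙ via their labels; the contracted M-edges are exactly the pairs of
-- division points; and the three E*-edges of an interval become the two new blue
-- edges (plus a contracted edge).
module Submission where

open import Defs
open import Data.Nat as ℕ using (ℕ; zero; suc; s≤s; z≤n)
import Data.Nat.Properties as ℕP
import Data.Nat.Solver
open import Data.Nat.Divisibility using (_∣_; _∣?_; divides; ∣⇒≤; ∣m+n∣m⇒∣n; m∣m*n; m*n∣⇒m∣; *-monoʳ-∣; *-cancelˡ-∣; 1∣_)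
open import Data.Nat.Primality using (Prime; prime?; euclidsLemma; prime⇒nonZero)
import Data.Nat.Coprimality as Coprime
open import Data.Integer as ℤ using (+_)
import Data.Integer.Properties as ℤP
open import Data.Rational
open import Data.Rational.Properties
open import Data.Rational.Unnormalised using (*≡*)
import Data.Rational.Unnormalised.Properties as ℚᵘP
open import Data.Rational.Solver using (module +-*-Solver)
open import Data.Product as Product using (Σ; ∃-syntax; _×_; _,_; proj₁; proj₂)
open import Data.Sum as Sum using (_⊎_; inj₁; inj₂)
open import Data.Empty using (⊥-elim)
open import Function using (_∘_)
open import Relation.Nullary using (¬_; yes; no)
open import Relation.Nullary.Decidable using (toWitness; toWitnessFalse)
open import Relation.Binary.PropositionalEquality

open +-*-Solver
module ℕS = Data.Nat.Solver.+-*-Solver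

-- The natural numbers inside ℚ, written so that toℚᵘ (ι k) is literally k/1.
ι : ℕ → ℚ
ι k = mkℚ (+ k) 0 (Coprime.sym (Coprime.1-coprimeTo k))

ι-+ : ∀ m n → ι (m ℕ.+ n) ≡ ι m + ι n
ι-+ m n = toℚᵘ-injective (ℚᵘP.≃-trans (*≡* (cong (ℤ._* + 1) (trans (ℤP.pos-+ m n)
  (sym (cong₂ ℤ._+_ (ℤP.*-identityʳ (+ m)) (ℤP.*-identityʳ (+ n)))))))
  (ℚᵘP.≃-sym (toℚᵘ-homo-+ (ι m) (ι n))))

ι-* : ∀ m n → ι (m ℕ.* n) ≡ ι m * ι n
ι-* m n = toℚᵘ-injective (ℚᵘP.≃-trans (*≡* (cong (ℤ._* + 1) (ℤP.pos-* m n)))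
  (ℚᵘP.≃-sym (toℚᵘ-homo-* (ι m) (ι n))))

scaled-integer : ∀ x K N → x * ι K ≡ ι N → ℤ.∣ ↥ x ∣ ℕ.* K ≡ N ℕ.* ↧ₙ x
scaled-integer x@(mkℚ p q _) K N eq
  with ℚᵘP.≃-trans (ℚᵘP.≃-sym (toℚᵘ-homo-* x (ι K))) (toℚᵘ-cong eq)
... | *≡* cross = begin
  ℤ.∣ p ∣ ℕ.* K                    ≡⟨ ℤP.abs-* p (+ K) ⟨
  ℤ.∣ p ℤ.* + K ∣                  ≡⟨ cong ℤ.∣_∣ (ℤP.*-identityʳ (p ℤ.* + K)) ⟨
  ℤ.∣ p ℤ.* + K ℤ.* + 1 ∣          ≡⟨ cong ℤ.∣_∣ cross ⟩
  ℤ.∣ + N ℤ.* (+ suc q ℤ.* + 1) ∣  ≡⟨ ℤP.abs-* (+ N) _ ⟩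
  N ℕ.* (suc q ℕ.* 1)              ≡⟨ cong (N ℕ.*_) (ℕP.*-identityʳ (suc q)) ⟩
  N ℕ.* suc q                      ∎
  where open ≡-Reasoning

prime-power-cancel : ∀ {p} → Prime p → ∀ k N q → ¬ p ∣ N → p ℕ.^ k ∣ N ℕ.* q → p ℕ.^ k ∣ q
prime-power-cancel pr zero N q _ _ = 1∣ q
prime-power-cancel {p} pr (suc k) N q p∤N pᵏ⁺¹∣Nq
  with euclidsLemma N q pr (m*n∣⇒m∣ p (p ℕ.^ k) pᵏ⁺¹∣Nq)
... | inj₁ p∣N = ⊥-elim (p∤N p∣N)
... | inj₂ (divides w refl) =
  subst (p ℕ.^ suc k ∣_) (ℕP.*-comm p w) (*-monoʳ-∣ p pᵏ∣w)
  where
    instance _ = prime⇒nonZero pr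
    regroup : ∀ N w p → N ℕ.* (w ℕ.* p) ≡ p ℕ.* (N ℕ.* w)
    regroup = ℕS.solve 3 (λ N w p → N ℕS.:* (w ℕS.:* p) ℕS.:= p ℕS.:* (N ℕS.:* w)) refl
    pᵏ∣Nw : p ℕ.^ k ∣ N ℕ.* w
    pᵏ∣Nw = *-cancelˡ-∣ p (subst (p ℕ.^ suc k ∣_) (regroup N w p) pᵏ⁺¹∣Nq)
    pᵏ∣w : p ℕ.^ k ∣ w
    pᵏ∣w = prime-power-cancel pr k N w p∤N pᵏ∣Nw

3-prime : Prime 3
3-prime = toWitness {a? = prime? 3} _

n<3^n : ∀ n → n ℕ.< 3 ℕ.^ n
n<3^n zero    = s≤s z≤n
n<3^n (suc n) = ℕP.≤-trans (ℕP.+-mono-≤ (ℕP.m^n>0 3 n) (n<3^n n))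
                           (ℕP.+-monoʳ-≤ (3 ℕ.^ n) (ℕP.m≤m+n (3 ℕ.^ n) _))

pow3 : ℕ → ℚ
pow3 n = ι (3 ℕ.^ n)

pow3-suc : ∀ n → pow3 (suc n) ≡ ι 3 * pow3 n
pow3-suc n = ι-* 3 (3 ℕ.^ n)

grid-point : ∀ {n a d A} → a * pow3 n ≡ ι A → d * pow3 n ≡ 1ℚ →
             ∀ j → (a + d * (ι j * third)) * pow3 (suc n) ≡ ι (3 ℕ.* A ℕ.+ j)
grid-point {n} {a} {d} {A} aP≡A dP≡1 j = begin
  (a + d * (ι j * third)) * pow3 (suc n)    ≡⟨ cong ((a + d * (ι j * third)) *_) (pow3-suc n) ⟩
  (a + d * (ι j * third)) * (ι 3 * pow3 n)  ≡⟨ expand a d (ι j) (pow3 n) ⟩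
  ι 3 * (a * pow3 n) + ι j * (d * pow3 n)   ≡⟨ cong₂ (λ u v → ι 3 * u + ι j * v) aP≡A dP≡1 ⟩
  ι 3 * ι A + ι j * 1ℚ                      ≡⟨ cong₂ _+_ (ι-* 3 A) (sym (*-identityʳ (ι j))) ⟨
  ι (3 ℕ.* A) + ι j                         ≡⟨ ι-+ (3 ℕ.* A) j ⟨
  ι (3 ℕ.* A ℕ.+ j)                         ∎
  where
    open ≡-Reasoning
    expand : ∀ a d J P → (a + d * (J * third)) * (ι 3 * P) ≡ ι 3 * (a * P) + J * (d * P)
    expand = solve 4 (λ a d J P → (a :+ d :* (J :* con third)) :* (con (ι 3) :* P)
                                  := con (ι 3) :* (a :* P) :+ J :* (d :* P)) refl

width-third : ∀ n d → d * pow3 n ≡ 1ℚ → d * third * pow3 (suc n) ≡ 1ℚ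
width-third n d dP≡1 = begin
  d * third * pow3 (suc n)    ≡⟨ cong (d * third *_) (pow3-suc n) ⟩
  d * third * (ι 3 * pow3 n)  ≡⟨ solve 2 (λ d P → d :* con third :* (con (ι 3) :* P) := d :* P) refl d (pow3 n) ⟩
  d * pow3 n                  ≡⟨ dP≡1 ⟩
  1ℚ                          ∎
  where open ≡-Reasoning

cantor-grid : ∀ {n a d} → CInt n a d → ∃[ A ] (a * pow3 n ≡ ι A × d * pow3 n ≡ 1ℚ)
cantor-grid base = 0 , refl , refl
cantor-grid (left {n} {a} {d} c) with cantor-grid c
... | A , aP≡A , dP≡1 = 3 ℕ.* A , left-end , width-third n d dP≡1
  where
    open ≡-Reasoning
    left-end : a * pow3 (suc n) ≡ ι (3 ℕ.* A)
    left-end = begin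
      a * pow3 (suc n)    ≡⟨ cong (a *_) (pow3-suc n) ⟩
      a * (ι 3 * pow3 n)  ≡⟨ solve 2 (λ a P → a :* (con (ι 3) :* P) := con (ι 3) :* (a :* P)) refl a (pow3 n) ⟩
      ι 3 * (a * pow3 n)  ≡⟨ cong (ι 3 *_) aP≡A ⟩
      ι 3 * ι A           ≡⟨ ι-* 3 A ⟨
      ι (3 ℕ.* A)         ∎
cantor-grid (right {n} {a} {d} c) with cantor-grid c
... | A , aP≡A , dP≡1 = 3 ℕ.* A ℕ.+ 2 , grid-point {n} {a} {d} aP≡A dP≡1 2 , width-third n d dP≡1

-- The division point a + d·j/3 (3 ∤ j) of an interval of 𝒞ₙ has denominator
-- divisible by 3ⁿ⁺¹, in particular at least n: enough fuel to descend n levels.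
inner-depth : ∀ {n a d} → CInt n a d → ∀ j → ¬ 3 ∣ j → n ℕ.≤ ↧ₙ (a + d * (ι j * third))
inner-depth {n} {a} {d} c j 3∤j with cantor-grid c
... | A , aP≡A , dP≡1 = ℕP.<⇒≤ (ℕP.<-≤-trans (n<3^n n) (ℕP.≤-trans 3ⁿ≤3ⁿ⁺¹ (∣⇒≤ pow∣den)))
  where
    3ⁿ≤3ⁿ⁺¹ : 3 ℕ.^ n ℕ.≤ 3 ℕ.^ suc n
    3ⁿ≤3ⁿ⁺¹ = ℕP.^-monoʳ-≤ 3 (ℕP.n≤1+n n)
    x : ℚ
    x = a + d * (ι j * third)
    3∤N : ¬ 3 ∣ 3 ℕ.* A ℕ.+ j
    3∤N 3∣N = 3∤j (∣m+n∣m⇒∣n 3∣N (m∣m*n A))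
    pow∣den : 3 ℕ.^ suc n ∣ ↧ₙ x
    pow∣den = prime-power-cancel 3-prime (suc n) (3 ℕ.* A ℕ.+ j) (↧ₙ x) 3∤N
      (divides ℤ.∣ ↥ x ∣ (sym (scaled-integer x (3 ℕ.^ suc n) _
                                (grid-point {n} {a} {d} aP≡A dP≡1 j))))

InUnit : ℚ → Set
InUnit x = 0ℚ ≤ x × x ≤ 1ℚ

right-third-lower : ∀ {x} → 0ℚ ≤ x → twoThirds ≤ twoThirds + third * x
right-third-lower 0≤x = +-monoʳ-≤ twoThirds (*-monoˡ-≤-nonNeg third 0≤x)

third∈I : InUnit third
third∈I = toWitness {a? = 0ℚ ≤? third} _ , toWitness {a? = third ≤? 1ℚ} _

twoThirds∈I : InUnit twoThirds
twoThirds∈I = toWitness {a? = 0ℚ ≤? twoThirds} _ , toWitness {a? = twoThirds ≤? 1ℚ} _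

inUnit-left : ∀ {x} → InUnit x → InUnit (third * x)
inUnit-left (0≤x , x≤1) = *-monoˡ-≤-nonNeg third 0≤x
                        , ≤-trans (*-monoˡ-≤-nonNeg third x≤1) (proj₂ third∈I)

inUnit-right : ∀ {x} → InUnit x → InUnit (twoThirds + third * x)
inUnit-right (0≤x , x≤1) = ≤-trans (proj₁ twoThirds∈I) (right-third-lower 0≤x)
                         , +-monoʳ-≤ twoThirds (*-monoˡ-≤-nonNeg third x≤1)

-- descend fuel x L R: the label of x ∈ [0,1] when [0,1] carries the labels L, R.
descend : ℕ → ℚ → FV → FV → FV
descend fuel x L R with x ≟ 0ℚ | x ≟ 1ℚ | x ≟ third | x ≟ twoThirds
... | yes _ | _     | _     | _     = L
... | no _  | yes _ | _     | _     = R
... | no _  | no _  | yes _ | _     = mid L R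
... | no _  | no _  | no _  | yes _ = mid L R
descend zero    x L R | no _ | no _ | no _ | no _ = L
descend (suc k) x L R | no _ | no _ | no _ | no _ with x <? third
... | yes _ = descend k (x * ι 3) L (mid L R)
... | no _  = descend k ((x - twoThirds) * ι 3) (mid L R) R

descend-cong : ∀ m {x y} L R → x ≡ y → descend m x L R ≡ descend m y L R
descend-cong m L R refl = refl

third-inverse : ∀ x → (third * x) * ι 3 ≡ x
third-inverse = solve 1 (λ x → (con third :* x) :* con (ι 3) := x) refl

twoThirds-inverse : ∀ x → ((twoThirds + third * x) - twoThirds) * ι 3 ≡ x
twoThirds-inverse = solve 1 (λ x → ((con twoThirds :+ con third :* x) :- con twoThirds) :* con (ι 3) := x) refl

third-unscale : ∀ {x y} → third * x ≡ y → x ≡ y * ι 3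
third-unscale {x} e = trans (sym (third-inverse x)) (cong (_* ι 3) e)

twoThirds-unscale : ∀ {x y} → twoThirds + third * x ≡ y → x ≡ (y - twoThirds) * ι 3
twoThirds-unscale {x} e = trans (sym (twoThirds-inverse x)) (cong (λ z → (z - twoThirds) * ι 3) e)

descend-left : ∀ m x L R → x ≤ 1ℚ →
               descend (suc m) (third * x) L R ≡ descend m x L (mid L R)
descend-left m x L R x≤1
  with third * x ≟ 0ℚ | third * x ≟ 1ℚ | third * x ≟ third | third * x ≟ twoThirds
... | yes x/3≡0 | _ | _ | _ = sym (descend-cong m L (mid L R) (third-unscale {x} x/3≡0))
... | no _ | yes x/3≡1 | _ | _ =
  ⊥-elim (toWitnessFalse {a? = ι 3 ≤? 1ℚ} _ (subst (_≤ 1ℚ) (third-unscale {x} x/3≡1) x≤1))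
... | no _ | no _ | yes x/3≡⅓ | _ = sym (descend-cong m L (mid L R) (third-unscale {x} x/3≡⅓))
... | no _ | no _ | no _ | yes x/3≡⅔ =
  ⊥-elim (toWitnessFalse {a? = ι 2 ≤? 1ℚ} _ (subst (_≤ 1ℚ) (third-unscale {x} x/3≡⅔) x≤1))
... | no _ | no _ | no x/3≢⅓ | no _ with third * x <? third
...   | yes _ = descend-cong m L (mid L R) (third-inverse x)
...   | no x/3≮⅓ = ⊥-elim (x/3≢⅓ (cong (third *_) (≤-antisym x≤1 1≤x)))
  where
    1≤x : 1ℚ ≤ x
    1≤x = subst (1ℚ ≤_) (third-inverse x) (*-monoʳ-≤-nonNeg (ι 3) (≮⇒≥ x/3≮⅓))

descend-right : ∀ m x L R → 0ℚ ≤ x →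
                descend (suc m) (twoThirds + third * x) L R ≡ descend m x (mid L R) R
descend-right m x L R 0≤x
  with twoThirds + third * x ≟ 0ℚ | twoThirds + third * x ≟ 1ℚ
     | twoThirds + third * x ≟ third | twoThirds + third * x ≟ twoThirds
... | yes y≡0 | _ | _ | _ =
  ⊥-elim (toWitnessFalse {a? = twoThirds ≤? 0ℚ} _ (subst (twoThirds ≤_) y≡0 (right-third-lower 0≤x)))
... | no _ | yes y≡1 | _ | _ = sym (descend-cong m (mid L R) R (twoThirds-unscale {x} y≡1))
... | no _ | no _ | yes y≡⅓ | _ =
  ⊥-elim (toWitnessFalse {a? = twoThirds ≤? third} _ (subst (twoThirds ≤_) y≡⅓ (right-third-lower 0≤x)))
... | no _ | no _ | no _ | yes y≡⅔ = sym (descend-cong m (mid L R) R (twoThirds-unscale {x} y≡⅔))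
... | no _ | no _ | no _ | no _ with twoThirds + third * x <? third
...   | no _ = descend-cong m (mid L R) R (twoThirds-inverse x)
...   | yes y<⅓ =
  ⊥-elim (toWitnessFalse {a? = twoThirds <? third} _ (≤-<-trans (right-third-lower 0≤x) y<⅓))

-- The labels of a Cantor interval: the endpoints of the blue edge it corresponds to.
mutual
  labelL : ∀ {n a d} → CInt n a d → FV
  labelL base      = l
  labelL (left c)  = labelL c
  labelL (right c) = mid (labelL c) (labelR c)

  labelR : ∀ {n a d} → CInt n a d → FV
  labelR base      = r
  labelR (left c)  = mid (labelL c) (labelR c)
  labelR (right c) = labelR c

descend-interval : ∀ {n a d} (c : CInt n a d) m x → InUnit x →
                   descend (n ℕ.+ m) (a + d * x) l r ≡ descend m x (labelL c) (labelR c)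
descend-interval base m x _ = descend-cong m l r (solve 1 (λ x → con 0ℚ :+ con 1ℚ :* x := x) refl x)
descend-interval (left {n} {a} {d} c) m x x∈I = begin
  descend (suc n ℕ.+ m) (a + d * third * x) l r      ≡⟨ cong₂ (λ k y → descend k y l r) (sym (ℕP.+-suc n m)) (assoc a d x) ⟩
  descend (n ℕ.+ suc m) (a + d * (third * x)) l r    ≡⟨ descend-interval c (suc m) (third * x) (inUnit-left x∈I) ⟩
  descend (suc m) (third * x) (labelL c) (labelR c)  ≡⟨ descend-left m x (labelL c) (labelR c) (proj₂ x∈I) ⟩
  descend m x (labelL c) (mid (labelL c) (labelR c)) ∎
  where
    open ≡-Reasoning
    assoc : ∀ a d x → a + d * third * x ≡ a + d * (third * x)
    assoc = solve 3 (λ a d x → a :+ d :* con third :* x := a :+ d :* (con third :* x)) refl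
descend-interval (right {n} {a} {d} c) m x x∈I = begin
  descend (suc n ℕ.+ m) (a + d * twoThirds + d * third * x) l r  ≡⟨ cong₂ (λ k y → descend k y l r) (sym (ℕP.+-suc n m)) (assoc a d x) ⟩
  descend (n ℕ.+ suc m) (a + d * (twoThirds + third * x)) l r    ≡⟨ descend-interval c (suc m) (twoThirds + third * x) (inUnit-right x∈I) ⟩
  descend (suc m) (twoThirds + third * x) (labelL c) (labelR c)  ≡⟨ descend-right m x (labelL c) (labelR c) (proj₁ x∈I) ⟩
  descend m x (mid (labelL c) (labelR c)) (labelR c)             ∎
  where
    open ≡-Reasoning
    assoc : ∀ a d x → a + d * twoThirds + d * third * x ≡ a + d * (twoThirds + third * x)
    assoc = solve 3 (λ a d x → a :+ d :* con twoThirds :+ d :* con third :* x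
                               := a :+ d :* (con twoThirds :+ con third :* x)) refl

toFarey : ℚ → FV
toFarey x = descend (↧ₙ x) x l r

toFarey-interval : ∀ {n a d} (c : CInt n a d) x → InUnit x → n ℕ.≤ ↧ₙ (a + d * x) →
                   toFarey (a + d * x) ≡ descend (↧ₙ (a + d * x) ℕ.∸ n) x (labelL c) (labelR c)
toFarey-interval {n} {a} {d} c x x∈I n≤den =
  trans (cong (λ k → descend k (a + d * x) l r) (sym (ℕP.m+[n∸m]≡n n≤den)))
        (descend-interval c (↧ₙ (a + d * x) ℕ.∸ n) x x∈I)

toFarey-third : ∀ {n a d} (c : CInt n a d) → toFarey (a + d * third) ≡ mid (labelL c) (labelR c)
toFarey-third c = toFarey-interval c third third∈I (inner-depth c 1 (toWitnessFalse {a? = 3 ∣? 1} _))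

toFarey-twoThirds : ∀ {n a d} (c : CInt n a d) → toFarey (a + d * twoThirds) ≡ mid (labelL c) (labelR c)
toFarey-twoThirds c = toFarey-interval c twoThirds twoThirds∈I (inner-depth c 2 (toWitnessFalse {a? = 3 ∣? 2} _))

right-end : ∀ a d → a + d * twoThirds + d * third ≡ a + d
right-end = solve 2 (λ a d → a :+ d :* con twoThirds :+ d :* con third := a :+ d) refl

toFarey-endpoints : ∀ {n a d} (c : CInt n a d) → toFarey a ≡ labelL c × toFarey (a + d) ≡ labelR c
toFarey-endpoints base = refl , refl
toFarey-endpoints (left c) = proj₁ (toFarey-endpoints c) , toFarey-third c
toFarey-endpoints (right {a = a} {d} c) =
  toFarey-twoThirds c , trans (cong toFarey (right-end a d)) (proj₂ (toFarey-endpoints c))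

blue-interval : ∀ {n a d} (c : CInt n a d) → Blue n (labelL c) (labelR c)
blue-interval base      = blue0
blue-interval (left c)  = blueL (blue-interval c)
blue-interval (right c) = blueR (blue-interval c)

interval-of-blue : ∀ {n u v} → Blue n u v →
                   ∃[ a ] ∃[ d ] Σ (CInt n a d) λ c → labelL c ≡ u × labelR c ≡ v
interval-of-blue blue0 = _ , _ , base , refl , refl
interval-of-blue (blueL b) with interval-of-blue b
... | _ , _ , c , refl , refl = _ , _ , left c , refl , refl
interval-of-blue (blueR b) with interval-of-blue b
... | _ , _ , c , refl , refl = _ , _ , right c , refl , refl

-- Vertices of F̌ are terms; a term differs from every term properly containing it.
size : FV → ℕ
size l         = 0
size r         = 0
size (mid u v) = suc (size u ℕ.+ size v)

size-≢ : ∀ {u v} → size u ℕ.< size v → u ≢ v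
size-≢ u<v refl = ℕP.<-irrefl refl u<v

mid-≢ˡ : ∀ u w → u ≢ mid u w
mid-≢ˡ u w = size-≢ (s≤s (ℕP.m≤m+n (size u) (size w)))

mid-≢ʳ : ∀ u w → w ≢ mid u w
mid-≢ʳ u w = size-≢ (s≤s (ℕP.m≤n+m (size w) (size u)))

nested-≢ : ∀ t u v → t ≢ mid (mid u t) v
nested-≢ t u v = size-≢ (s≤s (ℕP.≤-trans (ℕP.m≤n+m (size t) (suc (size u))) (ℕP.m≤m+n _ (size v))))

mid-injective : ∀ {u v u' v'} → mid u v ≡ mid u' v' → u ≡ u' × v ≡ v'
mid-injective refl = refl , refl

labels-injective : ∀ {n₁ a₁ d₁ n₂ a₂ d₂} (c₁ : CInt n₁ a₁ d₁) (c₂ : CInt n₂ a₂ d₂) →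
                   labelL c₁ ≡ labelL c₂ → labelR c₁ ≡ labelR c₂ → a₁ ≡ a₂ × d₁ ≡ d₂
labels-injective base      base      _  _  = refl , refl
labels-injective base      (left c₂) _  ()
labels-injective base      (right c₂) () _
labels-injective (left c₁) base      _  ()
labels-injective (right c₁) base     () _
labels-injective (left c₁) (left c₂) eL eR
  with labels-injective c₁ c₂ eL (proj₂ (mid-injective eR))
... | refl , refl = refl , refl
labels-injective (right c₁) (right c₂) eL eR
  with labels-injective c₁ c₂ (proj₁ (mid-injective eL)) eR
... | refl , refl = refl , refl
labels-injective (left c₁) (right c₂) eL eR = ⊥-elim (nested-≢ (labelR c₂) (labelL c₂) (labelR c₁)
  (trans (sym eR) (cong (λ u → mid u (labelR c₁)) eL)))
labels-injective (right c₁) (left c₂) eL eR = ⊥-elim (nested-≢ (labelR c₁) (labelL c₁) (labelR c₂)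
  (trans eR (cong (λ u → mid u (labelR c₂)) (sym eL))))

-- Every vertex of G* is 0, 1 or a division point of some interval; this is the
-- form in which toFarey is evaluated.
data Position (x : ℚ) : Set where
  at-0  : x ≡ 0ℚ → Position x
  at-1  : x ≡ 1ℚ → Position x
  inner : ∀ {n a d} (c : CInt n a d) → x ≡ a + d * third ⊎ x ≡ a + d * twoThirds → Position x

label : ∀ {x} → Position x → FV
label (at-0 _)    = l
label (at-1 _)    = r
label (inner c _) = mid (labelL c) (labelR c)

toFarey-position : ∀ {x} (p : Position x) → toFarey x ≡ label p
toFarey-position (at-0 x≡0)            = cong toFarey x≡0
toFarey-position (at-1 x≡1)            = cong toFarey x≡1
toFarey-position (inner c (inj₁ x≡⅓)) = trans (cong toFarey x≡⅓) (toFarey-third c)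
toFarey-position (inner c (inj₂ x≡⅔)) = trans (cong toFarey x≡⅔) (toFarey-twoThirds c)

endpoint-positions : ∀ {n a d} → CInt n a d → Position a × Position (a + d)
endpoint-positions base = at-0 refl , at-1 refl
endpoint-positions (left c) = proj₁ (endpoint-positions c) , inner c (inj₁ refl)
endpoint-positions (right {a = a} {d} c) =
  inner c (inj₂ refl) , subst Position (sym (right-end a d)) (proj₂ (endpoint-positions c))

position : ∀ {x} → GVert x → Position x
position (_ , _ , _ , c , inj₁ x≡a)   = subst Position (sym x≡a) (proj₁ (endpoint-positions c))
position (_ , _ , _ , c , inj₂ x≡a+d) = subst Position (sym x≡a+d) (proj₂ (endpoint-positions c))

inner-≈M : ∀ {n a d x y} (c : CInt n a d) →
           x ≡ a + d * third ⊎ x ≡ a + d * twoThirds → y ≡ a + d * third ⊎ y ≡ a + d * twoThirds → x ≈M y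
inner-≈M c (inj₁ x≡⅓) (inj₁ y≡⅓) = inj₁ (trans x≡⅓ (sym y≡⅓))
inner-≈M c (inj₁ x≡⅓) (inj₂ y≡⅔) = inj₂ (_ , _ , _ , c , inj₁ (x≡⅓ , y≡⅔))
inner-≈M c (inj₂ x≡⅔) (inj₁ y≡⅓) = inj₂ (_ , _ , _ , c , inj₂ (x≡⅔ , y≡⅓))
inner-≈M c (inj₂ x≡⅔) (inj₂ y≡⅔) = inj₁ (trans x≡⅔ (sym y≡⅔))

same-label : ∀ {x y} (p : Position x) (q : Position y) → label p ≡ label q → x ≈M y
same-label (at-0 x≡0) (at-0 y≡0) _ = inj₁ (trans x≡0 (sym y≡0))
same-label (at-1 x≡1) (at-1 y≡1) _ = inj₁ (trans x≡1 (sym y≡1))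
same-label (inner c₁ x∈c₁) (inner c₂ y∈c₂) e
  with labels-injective c₁ c₂ (proj₁ (mid-injective e)) (proj₂ (mid-injective e))
... | refl , refl = inner-≈M c₁ x∈c₁ y∈c₂
same-label (at-0 _) (at-1 _) ()
same-label (at-0 _) (inner _ _) ()
same-label (at-1 _) (at-0 _) ()
same-label (at-1 _) (inner _ _) ()
same-label (inner _ _) (at-0 _) ()
same-label (inner _ _) (at-1 _) ()

toFarey-respects : ∀ {x y} → x ≈M y → toFarey x ≡ toFarey y
toFarey-respects (inj₁ refl) = refl
toFarey-respects (inj₂ (_ , _ , _ , c , inj₁ (x≡⅓ , y≡⅔))) =
  trans (toFarey-position (inner c (inj₁ x≡⅓))) (sym (toFarey-position (inner c (inj₂ y≡⅔))))
toFarey-respects (inj₂ (_ , _ , _ , c , inj₂ (x≡⅔ , y≡⅓))) =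
  trans (toFarey-position (inner c (inj₂ x≡⅔))) (sym (toFarey-position (inner c (inj₁ y≡⅓))))

toFarey-reflects : ∀ {x y} → GVert x → GVert y → toFarey x ≡ toFarey y → x ≈M y
toFarey-reflects gx gy e =
  same-label (position gx) (position gy)
    (trans (sym (toFarey-position (position gx))) (trans e (toFarey-position (position gy))))

toFarey-vertex : ∀ {x} → GVert x → FVert (toFarey x)
toFarey-vertex (n , _ , _ , c , inj₁ x≡a) =
  suc n , labelR c , inj₁ (subst (λ u → Blue (suc n) u (labelR c))
                                 (sym (trans (cong toFarey x≡a) (proj₁ (toFarey-endpoints c)))) (blue-interval c))
toFarey-vertex (n , _ , _ , c , inj₂ x≡a+d) =
  suc n , labelL c , inj₂ (subst (Blue (suc n) (labelL c))
                                 (sym (trans (cong toFarey x≡a+d) (proj₂ (toFarey-endpoints c)))) (blue-interval c))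

left-end-vertex : ∀ {n a d} → CInt n a d → GVert a
left-end-vertex c = _ , _ , _ , left c , inj₁ refl

right-end-vertex : ∀ {n a d} → CInt n a d → GVert (a + d)
right-end-vertex {a = a} {d} c = _ , _ , _ , right c , inj₂ (sym (right-end a d))

third-vertex : ∀ {n a d} → CInt n a d → GVert (a + d * third)
third-vertex c = _ , _ , _ , left c , inj₂ refl

twoThirds-vertex : ∀ {n a d} → CInt n a d → GVert (a + d * twoThirds)
twoThirds-vertex c = _ , _ , _ , right c , inj₁ refl

toFarey-onto : ∀ v → FVert v → ∃[ x ] (GVert x × toFarey x ≡ v)
toFarey-onto v (_ , _ , inj₁ b) with interval-of-blue b
... | _ , _ , c , labelL≡v , _ = _ , left-end-vertex c , trans (proj₁ (toFarey-endpoints c)) labelL≡v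
toFarey-onto v (_ , _ , inj₂ b) with interval-of-blue b
... | _ , _ , c , _ , labelR≡v = _ , right-end-vertex c , trans (proj₂ (toFarey-endpoints c)) labelR≡v

later-blue-edge : ∀ {k u v} → Blue (suc k) u v → FEdge⁻ u v
later-blue-edge {k} b = (suc k , inj₁ b) , not-base b
  where
    not-base : ∀ {u v} → Blue (suc k) u v → ¬ ((u ≡ l × v ≡ r) ⊎ (u ≡ r × v ≡ l))
    not-base (blueL _) (inj₁ (_ , ()))
    not-base (blueL _) (inj₂ (_ , ()))
    not-base (blueR _) (inj₁ (() , _))
    not-base (blueR _) (inj₂ (() , _))

FEdge⁻-sym : ∀ {u v} → FEdge⁻ u v → FEdge⁻ v u
FEdge⁻-sym ((k , b) , not-base) = (k , Sum.swap b) , λ where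
  (inj₁ (v≡l , u≡r)) → not-base (inj₂ (u≡r , v≡l))
  (inj₂ (v≡r , u≡l)) → not-base (inj₁ (u≡l , v≡r))

samePair-edge : ∀ {x y p q} → SamePair x y p q →
                FEdge⁻ (toFarey p) (toFarey q) → FEdge⁻ (toFarey x) (toFarey y)
samePair-edge (inj₁ (refl , refl)) e = e
samePair-edge (inj₂ (refl , refl)) e = FEdge⁻-sym e

-- Adjacent classes map to adjacent vertices: the outer E*-edges of an interval c
-- become the two blue edges created on the edge of c; the middle one is in M.
toFarey-adjacent : ∀ {x y} → GVert x → GVert y → QAdj x y → FEdge⁻ (toFarey x) (toFarey y)
toFarey-adjacent gx gy (x≉y , x' , y' , x≈x' , y≈y' , (k , a , d , c , kind)) =
  subst₂ FEdge⁻ (sym (toFarey-respects x≈x')) (sym (toFarey-respects y≈y')) (image kind)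
  where
    image : SamePair x' y' a (a + d * twoThirds)
            ⊎ SamePair x' y' (a + d * third) (a + d * twoThirds)
            ⊎ SamePair x' y' (a + d * third) (a + d) → FEdge⁻ (toFarey x') (toFarey y')
    image (inj₁ outer-left) = samePair-edge outer-left
      (subst₂ FEdge⁻ (sym (proj₁ (toFarey-endpoints c))) (sym (toFarey-twoThirds c))
              (later-blue-edge (blueL (blue-interval c))))
    image (inj₂ (inj₁ middle)) = ⊥-elim (x≉y (toFarey-reflects gx gy
      (trans (toFarey-respects x≈x') (trans (toFarey-respects (inj₂ (k , a , d , c , middle)))
                                            (sym (toFarey-respects y≈y'))))))
    image (inj₂ (inj₂ outer-right)) = samePair-edge outer-right
      (subst₂ FEdge⁻ (sym (toFarey-third c)) (sym (proj₂ (toFarey-endpoints c)))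
              (later-blue-edge (blueR (blue-interval c))))

SamePair-sym : ∀ {x y u v} → SamePair x y u v → SamePair y x u v
SamePair-sym = Sum.swap ∘ Sum.map Product.swap Product.swap

≈M-sym : ∀ {x y} → x ≈M y → y ≈M x
≈M-sym (inj₁ x≡y)                  = inj₁ (sym x≡y)
≈M-sym (inj₂ (n , a , d , c , sp)) = inj₂ (n , a , d , c , SamePair-sym sp)

GEdge-sym : ∀ {x y} → GEdge x y → GEdge y x
GEdge-sym (n , a , d , c , kind) =
  n , a , d , c , Sum.map SamePair-sym (Sum.map SamePair-sym SamePair-sym) kind

QAdj-sym : ∀ {x y} → QAdj x y → QAdj y x
QAdj-sym (x≉y , x' , y' , x≈x' , y≈y' , e) = x≉y ∘ ≈M-sym , y' , x' , y≈y' , x≈x' , GEdge-sym e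

blue-adjacent : ∀ {k u v x y} → Blue k u v → toFarey x ≡ u → toFarey y ≡ v →
                ¬ ((toFarey x ≡ l × toFarey y ≡ r) ⊎ (toFarey x ≡ r × toFarey y ≡ l)) →
                GVert x → GVert y → QAdj x y
blue-adjacent blue0 fx≡l fy≡r not-base _ _ = ⊥-elim (not-base (inj₁ (fx≡l , fy≡r)))
blue-adjacent (blueL {x = u} {w} b) fx≡u fy≡m _ gx gy with interval-of-blue b
... | a , d , c , refl , refl =
  (λ x≈y → mid-≢ˡ u w (trans (sym fx≡u) (trans (toFarey-respects x≈y) fy≡m))) ,
  a , a + d * twoThirds ,
  toFarey-reflects gx (left-end-vertex c) (trans fx≡u (sym (proj₁ (toFarey-endpoints c)))) ,
  toFarey-reflects gy (twoThirds-vertex c) (trans fy≡m (sym (toFarey-twoThirds c))) ,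
  (_ , a , d , c , inj₁ (inj₁ (refl , refl)))
blue-adjacent (blueR {x = u} {w} b) fx≡m fy≡w _ gx gy with interval-of-blue b
... | a , d , c , refl , refl =
  (λ x≈y → mid-≢ʳ u w (trans (sym fy≡w) (trans (sym (toFarey-respects x≈y)) fx≡m))) ,
  a + d * third , a + d ,
  toFarey-reflects gx (third-vertex c) (trans fx≡m (sym (toFarey-third c))) ,
  toFarey-reflects gy (right-end-vertex c) (trans fy≡w (sym (proj₂ (toFarey-endpoints c)))) ,
  (_ , a , d , c , inj₂ (inj₂ (inj₁ (refl , refl))))

toFarey-adjacent⁻¹ : ∀ {x y} → GVert x → GVert y → FEdge⁻ (toFarey x) (toFarey y) → QAdj x y
toFarey-adjacent⁻¹ gx gy ((_ , inj₁ b) , not-base) = blue-adjacent b refl refl not-base gx gy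
toFarey-adjacent⁻¹ gx gy ((k , inj₂ b) , not-base) =
  QAdj-sym (blue-adjacent b refl refl (proj₂ (FEdge⁻-sym ((k , inj₂ b) , not-base))) gy gx)

lemma3p1 : ∃[ f ] (IsQuotIso f ×
             ((f 0ℚ ≡ l × f 1ℚ ≡ r) ⊎ (f 0ℚ ≡ r × f 1ℚ ≡ l)))
lemma3p1 = toFarey , iso , inj₁ (refl , refl)
  where
    iso : IsQuotIso toFarey
    iso = record
      { into    = λ _ → toFarey-vertex
      ; onto    = toFarey-onto
      ; respect = λ _ _ _ _ → toFarey-respects
      ; reflect = λ _ _ → toFarey-reflects
      ; adj→    = λ _ _ → toFarey-adjacent
      ; adj←    = λ _ _ → toFarey-adjacent⁻¹
      }
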